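{- Let $i\in I$ and let $\Lambda_i:\Omega\to2^\Omega$ satisfy Strong Confinement and Projections Preserve Implicit Knowledge. Then $\Lambda_i$ satisfies Projections Preserve Implicit Ignorance: for all $\Phi\subseteq\mathsf{At}$, if $\omega\in S_\Phi$, then $\Lambda_i(\omega)^\uparrow\subseteq\Lambda_i(\omega_\Psi)^\uparrow$ for all $\Psi\subseteq\Phi$.
   Context: Fix a non-empty set $\mathsf{At}$. There are non-empty pairwise disjoint state spaces $S_\Phi$, one for each $\Phi\subseteq\mathsf{At}$, with $\Omega=\bigcup_\Phi S_\Phi$, and surjections $r^\Phi_\Psi:S_\Phi\to S_\Psi$ for $\Psi\subseteq\Phi$, with $r^\Phi_\Phi$ the identity and $r^\Phi_\Upsilon=r^\Psi_\Upsilon\circ r^\Phi_\Psi$ for $\Upsilon\subseteq\Psi\subseteq\Phi$. For $\omega\in S_\Phi$, $\omega_\Psi:=r^\Phi_\Psi(\omega)$; for $D\subseteq S_\Phi$, $D_\Psi:=r^\Phi_\Psi(D)$ and $D^\uparrow:=\bigcup_{\Phi\subseteq\Psi'\subseteq\mathsf{At}}(r^{\Psi'}_\Phi)^{ -1}(D)$. Strong Confinement: for every $\Phi$ and $\omega\in S_\Phi$, $\Lambda_i(\omega)\subseteq S_\Phi$. Projections Preserve Implicit Knowledge: for every $\Phi$, if $\omega\in S_\Phi$ then $\Lambda_i(\omega)_\Psi=\Lambda_i(\omega_\Psi)$ for all $\Psi\subseteq\Phi$. -}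

module Defs where

open import Level using (0ℓ)
open import Data.Product using (Σ; Σ-syntax; ∃; _×_; _,_; proj₁; proj₂)
open import Relation.Unary using (Pred; _⊆_)
open import Relation.Binary.PropositionalEquality using (_≡_)
open import Function using (Surjective)

Sub : Set → Set₁
Sub At = Pred At 0ℓ

record StateStructure (At : Set) : Set₂ where
  field
    nonemptyAt : At
    S          : Sub At → Set
    nonemptyS  : (Φ : Sub At) → S Φ
    r          : (Φ Ψ : Sub At) → Ψ ⊆ Φ → S Φ → S Ψ
    r-surj     : (Φ Ψ : Sub At) (p : Ψ ⊆ Φ) → Surjective _≡_ _≡_ (r Φ Ψ p)
    r-id       : (Φ : Sub At) (p : Φ ⊆ Φ) (x : S Φ) → r Φ Φ p x ≡ x
    r-comp     : (Φ Ψ Υ : Sub At) (p : Ψ ⊆ Φ) (q : Υ ⊆ Ψ) (pq : Υ ⊆ Φ) (x : S Φ) →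
                 r Φ Υ pq x ≡ r Ψ Υ q (r Φ Ψ p x)

  -- Ω = disjoint union of the S_Φ; ω ∈ S_Φ iff its index is Φ.
  Ω : Set₁
  Ω = Σ (Sub At) S

  -- D_Ψ := r^Φ_Ψ(D) for D ⊆ S_Φ, as a subset of Ω (lying in S_Ψ).
  proj : (Φ Ψ : Sub At) → Ψ ⊆ Φ → Pred Ω 0ℓ → Pred Ω (Level.suc 0ℓ)
  proj Φ Ψ p D ω' = Σ[ x ∈ S Φ ] (D (Φ , x) × ((Ψ , r Φ Ψ p x) ≡ ω'))

  -- D↑ := ⋃_{Φ ⊆ Ψ'} (r^{Ψ'}_Φ)⁻¹(D) for D ⊆ S_Φ, as a subset of Ω.
  up : (Φ : Sub At) → Pred Ω 0ℓ → Pred Ω 0ℓ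
  up Φ D (Ψ' , y) = Σ[ p ∈ Φ ⊆ Ψ' ] D (Φ , r Ψ' Φ p y)

  StrongConfinement : (Ω → Pred Ω 0ℓ) → Set₁
  StrongConfinement Λ = (Φ : Sub At) (x : S Φ) (ω' : Ω) → Λ (Φ , x) ω' → proj₁ ω' ≡ Φ

  PPIK : (Ω → Pred Ω 0ℓ) → Set₁
  PPIK Λ = (Φ : Sub At) (x : S Φ) (Ψ : Sub At) (p : Ψ ⊆ Φ) →
           (proj Φ Ψ p (Λ (Φ , x)) ⊆ Λ (Ψ , r Φ Ψ p x)) ×
           (Λ (Ψ , r Φ Ψ p x) ⊆ proj Φ Ψ p (Λ (Φ , x)))

  PPII : (Ω → Pred Ω 0ℓ) → Set₁
  PPII Λ = (Φ : Sub At) (x : S Φ) (Ψ : Sub At) (p : Ψ ⊆ Φ) →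
           up Φ (Λ (Φ , x)) ⊆ up Ψ (Λ (Ψ , r Φ Ψ p x))

-- If ω' ∈ Λ(ω)↑ lies in S_Ψ' with Φ ⊆ Ψ', then ω'_Φ ∈ Λ(ω), so by transitivity of the
-- projections ω'_Ψ = (ω'_Φ)_Ψ ∈ Λ(ω)_Ψ, and Λ(ω)_Ψ ⊆ Λ(ω_Ψ) is half of Projections
-- Preserve Implicit Knowledge. Hence ω' ∈ Λ(ω_Ψ)↑.
module Submission where

open import Defs
open import Level using (0ℓ)
open import Relation.Unary using (Pred; _⊆_)
open import Data.Product using (_,_; proj₁)
open import Relation.Binary.PropositionalEquality using (refl; subst; sym)

module _ {At : Set} (M : StateStructure At) where
  open StateStructure M

  up-proj-⊆ : (Φ Ψ : Sub At) (p : Ψ ⊆ Φ) (D E : Pred Ω 0ℓ) →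
              proj Φ Ψ p D ⊆ E → up Φ D ⊆ up Ψ E
  up-proj-⊆ Φ Ψ p D E projD⊆E {Ψ' , y} (q , yΦ∈D) =
    Ψ⊆Ψ' , subst (λ z → E (Ψ , z)) (sym (r-comp Ψ' Φ Ψ q p Ψ⊆Ψ' y))
                 (projD⊆E (r Ψ' Φ q y , yΦ∈D , refl))
    where
    Ψ⊆Ψ' : Ψ ⊆ Ψ'
    Ψ⊆Ψ' a∈Ψ = q (p a∈Ψ)

lemma3 : (At : Set) (M : StateStructure At) (I : Set) (i : I)
    (Λ : I → StateStructure.Ω M → Pred (StateStructure.Ω M) 0ℓ) →
    StateStructure.StrongConfinement M (Λ i) →
    StateStructure.PPIK M (Λ i) →
    StateStructure.PPII M (Λ i)
lemma3 At M I i Λ _ ppik Φ x Ψ p =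
  up-proj-⊆ M Φ Ψ p (Λ i (Φ , x)) (Λ i (Ψ , r Φ Ψ p x)) (proj₁ (ppik Φ x Ψ p))
  where open StateStructure M
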